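{- Let $t, b \ge 1$ be integers and $T$ a finite non-empty subset of $\mathbb{Z}^b$. Let $S$ be a set and let $\mathcal{F}$ be a family of at least $(t-1)|T|^2$ pairwise disjoint subsets of $S$. Then there is a set $X \subset \mathbb{Z}^b \times S$ such that: (i) $X$ is a union of pairwise disjoint sets of the form $(T+x)\times A$ with $x\in\mathbb{Z}^b$ and $A\in\mathcal{F}$; and (ii) for each $x\in\mathbb{Z}^b$ there is some $m\equiv 1\pmod t$ such that $\{y\in S : (x,y)\in X\}$ is a union of $m$ distinct members of $\mathcal{F}$. -}

module Defs where

open import Data.Nat using (ℕ)
open import Data.Integer using (ℤ; +_; _-_) renaming (_+_ to _+ℤ_)
open import Data.Integer.Divisibility using (_∣_)
open import Data.Vec using (Vec; zipWith)
open import Data.List using (List)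
open import Data.List.Membership.Propositional using (_∈_)
open import Data.Product using (Σ; ∃; _×_)
open import Relation.Binary.PropositionalEquality using (_≡_)

ℤ^ : ℕ → Set
ℤ^ b = Vec ℤ b

_⊕_ : ∀ {b} → ℤ^ b → ℤ^ b → ℤ^ b
_⊕_ = zipWith _+ℤ_

-- z ∈ T + x   (T a finite subset of ℤ^b given as a duplicate-free list)
_∈Translate_by_ : ∀ {b} → ℤ^ b → List (ℤ^ b) → ℤ^ b → Set
z ∈Translate T by x = Σ _ λ y → (y ∈ T) × (z ≡ y ⊕ x)

_≡_[mod_] : ℕ → ℕ → ℕ → Set
m ≡ a [mod t ] = (+ t) ∣ ((+ m) - (+ a))

-- The proof reduces to one dimension.  An additive map Φ : ℤ^b → ℤ, injective on T
-- (read vectors as digits in a large base), turns T into offsets G ⊆ [0, W] with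
-- 0, W ∈ G, namely Φ τ = base + offset τ.  On ℤ we then build
--  * weights m : ℤ → [0, t) such that every window {w - g : g ∈ G} has total weight
--    1 modulo t (course-of-values recursion on each half-line, glued by reflection);
--  * a colouring of ℤ with |G|² = |T|² colours under which the points of each window
--    have distinct colours (greedy colouring avoiding the positive gaps of G).
-- On the translate T + y we place m(ℓ) sets with labels (k, colour ℓ), k < m(ℓ),
-- where ℓ = Φ y + base is the level of y; there are at most (t - 1)|T|² labels.  The
-- tiles through x are anchored at x ⊖ τ, τ ∈ T, whose levels form the window of Φ x:
-- so x is covered 1 mod t times, by distinct sets since the window's colours differ.
-- The file develops integer and list preliminaries, the weights, the colourings, the
-- projection and offsets, the tiling built from them (module Tiling), and lemma13.
module Submission where

open import Defs
open import Data.Nat using (ℕ; zero; suc; _+_; _*_; _∸_; _^_; _≤_; _<_; z≤n; s≤s; _≤?_; _<?_; _≟_)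
import Data.Nat.Properties as ℕP
open import Data.Nat.DivMod using (_%_; _/_; m%n<n; m≡m%n+[m/n]*n)
open import Data.Nat.ListAction using (sum)
open import Data.Integer using (ℤ; +_; -[1+_]; ∣_∣; 0ℤ) renaming (_+_ to _+ℤ_; _-_ to _-ℤ_; _*_ to _*ℤ_; -_ to -ℤ_; _≤_ to _≤ℤ_)
import Data.Integer.Properties as ℤP
open import Data.Integer.Divisibility.Signed using (divides; ∣⇒∣ᵤ)
open import Data.Integer.Tactic.RingSolver using (solve-∀)
import Data.Nat.Tactic.RingSolver as ℕ-Ring
open import Data.Fin as Fin using (Fin)
import Data.Fin.Properties as FinP
open import Data.Vec using ([]; _∷_; zipWith)
open import Data.Vec.Properties using (≡-dec)
open import Data.List using (List; []; _∷_; map; filter; length; concatMap; tabulate; lookup; cartesianProductWith)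
open import Data.List.Properties using (filter-accept; filter-reject; filter-all; filter-notAll; map-∘; map-cong; length-map; length-++; length-tabulate)
import Data.List.Extrema as Extrema
open import Data.List.Membership.Propositional using (_∈_; _∉_; find; lose)
open import Data.List.Membership.Propositional.Properties using (∈-filter⁺; ∈-filter⁻; ∈-map⁺; ∈-map⁻; ∈-cartesianProductWith⁺; ∈-concatMap⁺; ∈-concatMap⁻; ∈-tabulate⁻; ∈-lookup)
import Data.List.Membership.DecPropositional as DecMembership
open import Data.List.Membership.Setoid.Properties using (index-injective)
open import Data.List.Relation.Unary.Any using (Any; here; there; index)
open import Data.List.Relation.Unary.Any.Properties using (lookup-index)
import Data.List.Relation.Unary.All as All
import Data.List.Relation.Unary.All.Properties as AllP
open import Data.List.Relation.Unary.AllPairs using ([]; _∷_)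
open import Data.List.Relation.Unary.Unique.Propositional using (Unique)
import Data.List.Relation.Unary.Unique.Propositional.Properties as UniqueP
open import Data.List.Relation.Binary.Disjoint.Propositional using (Disjoint)
open import Data.Product using (Σ; ∃; _×_; _,_; proj₁; proj₂)
open import Data.Sum using (_⊎_; inj₁; inj₂)
open import Data.Empty using (⊥; ⊥-elim)
open import Relation.Nullary using (¬_; yes; no; ¬?; contradiction)
open import Relation.Binary using (Tri; tri<; tri≈; tri>)
open import Relation.Binary.PropositionalEquality using (_≡_; _≢_; refl; sym; trans; cong; cong₂; subst; setoid; module ≡-Reasoning)
open import Function using (id; _∘_)
open import Function.Definitions using (Injective)

glue : {A : Set} → (ℕ → A) → (ℕ → A) → ℤ → A
glue f g (+ n)    = f n
glue f g -[1+ n ] = g n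

minus-≥ : ∀ {n d} → d ≤ n → + n -ℤ + d ≡ + (n ∸ d)
minus-≥ {n} {d} d≤n = trans (ℤP.m-n≡m⊖n n d) (ℤP.⊖-≥ d≤n)

minus-< : ∀ {n d} → n < d → ∃ λ k → + n -ℤ + d ≡ -[1+ k ]
minus-< {n} {suc d} (s≤s n≤d) =
  d ∸ n , trans (ℤP.m-n≡m⊖n n (suc d)) (trans (ℤP.⊖-< (s≤s n≤d)) (cong (λ k → -ℤ + k) (ℕP.+-∸-assoc 1 n≤d)))

negative-minus : ∀ n d → -[1+ n ] -ℤ + d ≡ -[1+ (n + d) ]
negative-minus n zero    = cong -[1+_] (sym (ℕP.+-identityʳ n))
negative-minus n (suc d) = cong -[1+_] (sym (ℕP.+-suc n d))

-- Course-of-values recursion: value n = step n h, where h is a total function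
-- that agrees with value below n (and is arbitrary elsewhere).
module CourseOfValues {A : Set} (default : A) (step : ℕ → (ℕ → A) → A) where

  history : ℕ → ℕ → A
  history zero    i = default
  history (suc n) i with i ≟ n
  ... | yes _ = step n (history n)
  ... | no  _ = history n i

  value : ℕ → A
  value n = step n (history n)

  history-correct : ∀ {n i} → i < n → history n i ≡ value i
  history-correct {suc n} {i} i<1+n with i ≟ n
  ... | yes refl = refl
  ... | no  i≢n  = history-correct (ℕP.≤∧≢⇒< (ℕP.≤-pred i<1+n) i≢n)

sum-cong : ∀ {A : Set} {f g : A → ℕ} (xs : List A) → (∀ {x} → x ∈ xs → f x ≡ g x) →
           sum (map f xs) ≡ sum (map g xs)
sum-cong []       f≗g = refl
sum-cong (x ∷ xs) f≗g = cong₂ _+_ (f≗g (here refl)) (sum-cong xs (f≗g ∘ there))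

others : ℕ → List ℕ → List ℕ
others x = filter (λ y → ¬? (y ≟ x))

sum-others : ∀ (f : ℕ → ℕ) {x} xs → Unique xs → x ∈ xs →
             sum (map f xs) ≡ f x + sum (map f (others x xs))
sum-others f (y ∷ xs) (y∉xs ∷ _) (here refl) =
  cong (λ zs → f y + sum (map f zs))
       (sym (trans (filter-reject (λ z → ¬? (z ≟ y)) (λ y≢y → y≢y refl))
                   (filter-all (λ z → ¬? (z ≟ y)) (All.map (λ y≢z z≡y → y≢z (sym z≡y)) y∉xs))))
sum-others f {x} (y ∷ xs) (y∉xs ∷ uxs) (there x∈xs) = begin
  f y + sum (map f xs)                       ≡⟨ cong (λ z → f y + z) (sum-others f xs uxs x∈xs) ⟩
  f y + (f x + sum (map f (others x xs)))    ≡⟨ swap (f y) (f x) _ ⟩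
  f x + (f y + sum (map f (others x xs)))    ≡⟨ cong (λ zs → f x + sum (map f zs)) (filter-accept (λ z → ¬? (z ≟ x)) y≢x) ⟨
  f x + sum (map f (others x (y ∷ xs)))      ∎
  where
  open ≡-Reasoning
  y≢x : y ≢ x
  y≢x = All.lookup y∉xs x∈xs
  swap : ∀ a b c → a + (b + c) ≡ b + (a + c)
  swap = ℕ-Ring.solve-∀

map-unique : ∀ {A B : Set} (f : A → B) {xs : List A} → Unique xs →
             (∀ {x y} → x ∈ xs → y ∈ xs → f x ≡ f y → x ≡ y) → Unique (map f xs)
map-unique f {[]}     _            _   = []
map-unique f {x ∷ xs} (x∉xs ∷ uxs) inj =
  AllP.map⁺ (All.tabulate (λ y∈xs fx≡fy → All.lookup x∉xs y∈xs (inj (here refl) (there y∈xs) fx≡fy)))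
  ∷ map-unique f uxs (λ p q → inj (there p) (there q))

length-concatMap : ∀ {A B : Set} (f : A → List B) xs → length (concatMap f xs) ≡ sum (map (length ∘ f) xs)
length-concatMap f []       = refl
length-concatMap f (x ∷ xs) = trans (length-++ (f x)) (cong (λ n → length (f x) + n) (length-concatMap f xs))

concatMap-unique : ∀ {A B : Set} (f : A → List B) {xs} → Unique xs →
                   (∀ {x} → x ∈ xs → Unique (f x)) →
                   (∀ {x y} → x ∈ xs → y ∈ xs → x ≢ y → Disjoint (f x) (f y)) →
                   Unique (concatMap f xs)
concatMap-unique f {[]}     _            _      _     = []
concatMap-unique f {x ∷ xs} (x∉xs ∷ uxs) blocks apart =
  UniqueP.++⁺ (blocks (here refl)) (concatMap-unique f uxs (blocks ∘ there) (λ p q → apart (there p) (there q))) first-apart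
  where
  first-apart : Disjoint (f x) (concatMap f xs)
  first-apart (v∈fx , v∈rest) with find (∈-concatMap⁻ f {xs = xs} v∈rest)
  ... | y , y∈xs , v∈fy = apart (here refl) (there y∈xs) (All.lookup x∉xs y∈xs) (v∈fx , v∈fy)

lookup-injective : ∀ {A : Set} {xs : List A} → Unique xs → Injective _≡_ _≡_ (lookup xs)
lookup-injective {xs = x ∷ xs} (x∉xs ∷ uxs) {Fin.zero}  {Fin.zero}  _ = refl
lookup-injective {xs = x ∷ xs} (x∉xs ∷ uxs) {Fin.zero}  {Fin.suc j} e = ⊥-elim (All.lookup x∉xs (∈-lookup j) e)
lookup-injective {xs = x ∷ xs} (x∉xs ∷ uxs) {Fin.suc i} {Fin.zero}  e = ⊥-elim (All.lookup x∉xs (∈-lookup i) (sym e))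
lookup-injective {xs = x ∷ xs} (x∉xs ∷ uxs) {Fin.suc i} {Fin.suc j} e = cong Fin.suc (lookup-injective uxs e)

length-cartesianProductWith : ∀ {A B C : Set} (f : A → B → C) xs ys →
                              length (cartesianProductWith f xs ys) ≡ length xs * length ys
length-cartesianProductWith f []       ys = refl
length-cartesianProductWith f (x ∷ xs) ys =
  trans (length-++ (map (f x) ys)) (cong₂ _+_ (length-map (f x) ys) (length-cartesianProductWith f xs ys))

≡-mod-intro : ∀ {m a t} q k → m + q * t ≡ a + k * t → m ≡ a [mod t ]
≡-mod-intro {m} {a} {t} q k eq = ∣⇒∣ᵤ (divides (+ k -ℤ + q) (begin
  + m -ℤ + a                                    ≡⟨ shift (+ m) (+ a) (+ q) (+ t) ⟩
  (+ m +ℤ + q *ℤ + t) -ℤ (+ a +ℤ + q *ℤ + t)    ≡⟨ cong (_-ℤ (+ a +ℤ + q *ℤ + t)) eqℤ ⟩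
  (+ a +ℤ + k *ℤ + t) -ℤ (+ a +ℤ + q *ℤ + t)    ≡⟨ cancel (+ a) (+ k) (+ q) (+ t) ⟩
  (+ k -ℤ + q) *ℤ + t                           ∎))
  where
  open ≡-Reasoning
  embed : ∀ x y → + (x + y * t) ≡ + x +ℤ + y *ℤ + t
  embed x y = trans (ℤP.pos-+ x (y * t)) (cong (+ x +ℤ_) (ℤP.pos-* y t))
  eqℤ : + m +ℤ + q *ℤ + t ≡ + a +ℤ + k *ℤ + t
  eqℤ = trans (sym (embed m q)) (trans (cong +_ eq) (embed a k))
  shift : ∀ x y u v → x -ℤ y ≡ (x +ℤ u *ℤ v) -ℤ (y +ℤ u *ℤ v)
  shift = solve-∀
  cancel : ∀ x u w v → (x +ℤ u *ℤ v) -ℤ (x +ℤ w *ℤ v) ≡ (u -ℤ w) *ℤ v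
  cancel = solve-∀

complement : ℕ → ℕ → ℕ
complement t′ S = (1 + t′ * S) % suc t′

complement<t : ∀ t′ S → complement t′ S < suc t′
complement<t t′ S = m%n<n (1 + t′ * S) (suc t′)

complement-spec : ∀ (t′ S : ℕ) → (complement t′ S + S) ≡ 1 [mod suc t′ ]
complement-spec t′ S = ≡-mod-intro q S (begin
  r + S + q * suc t′     ≡⟨ regroup r S (q * suc t′) ⟩
  r + q * suc t′ + S     ≡⟨ cong (_+ S) (m≡m%n+[m/n]*n (1 + t′ * S) (suc t′)) ⟨
  1 + t′ * S + S         ≡⟨ expand t′ S ⟩
  1 + S * suc t′         ∎)
  where
  open ≡-Reasoning
  r q : ℕ
  r = complement t′ S
  q = (1 + t′ * S) / suc t′
  regroup : ∀ a b c → a + b + c ≡ a + c + b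
  regroup = ℕ-Ring.solve-∀
  expand : ∀ t S → 1 + t * S + S ≡ 1 + S * suc t
  expand = ℕ-Ring.solve-∀

record HalfLineWeights (t W : ℕ) (G : List ℕ) : Set where
  field
    weight   : ℕ → ℕ
    weight<t : ∀ n → weight n < t
    vanish   : ∀ {n} → n < W → weight n ≡ 0
    window   : ∀ {n} → W ≤ n → sum (map (λ g → weight (n ∸ g)) G) ≡ 1 [mod t ]

-- They exist when 0 ∈ G ⊆ [0, W]: the window at n determines weight n from
-- the weights at the earlier points n ∸ g, g ∈ G \ {0}.
halfLineWeights : ∀ t′ W (G : List ℕ) → Unique G → 0 ∈ G → (∀ {g} → g ∈ G → g ≤ W) →
                  HalfLineWeights (suc t′) W G
halfLineWeights t′ W G uniqueG 0∈G G≤W = record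
  { weight = value ; weight<t = weight<t ; vanish = vanish ; window = window }
  where
  step : ℕ → (ℕ → ℕ) → ℕ
  step n h with W ≤? n
  ... | yes _ = complement t′ (sum (map (λ g → h (n ∸ g)) (others 0 G)))
  ... | no  _ = 0

  open CourseOfValues 0 step

  weight<t : ∀ n → value n < suc t′
  weight<t n with W ≤? n
  ... | yes _ = complement<t t′ _
  ... | no  _ = s≤s z≤n

  vanish : ∀ {n} → n < W → value n ≡ 0
  vanish {n} n<W with W ≤? n
  ... | yes W≤n = contradiction W≤n (ℕP.<⇒≱ n<W)
  ... | no  _   = refl

  active : ∀ {n} → W ≤ n → value n ≡ complement t′ (sum (map (λ g → history n (n ∸ g)) (others 0 G)))
  active {n} W≤n with W ≤? n
  ... | yes _   = refl
  ... | no  W≰n = contradiction W≤n W≰n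

  -- Positive offsets look strictly into the past, where the history is correct.
  past : ∀ {n} → W ≤ n → sum (map (λ g → history n (n ∸ g)) (others 0 G)) ≡ sum (map (λ g → value (n ∸ g)) (others 0 G))
  past {n} W≤n = sum-cong (others 0 G) λ g∈ →
    let g∈G , g≢0 = ∈-filter⁻ (λ y → ¬? (y ≟ 0)) g∈ in
    history-correct (ℕP.∸-monoʳ-< (ℕP.n≢0⇒n>0 g≢0) (ℕP.≤-trans (G≤W g∈G) W≤n))

  window : ∀ {n} → W ≤ n → sum (map (λ g → value (n ∸ g)) G) ≡ 1 [mod suc t′ ]
  window {n} W≤n = subst (_≡ 1 [mod suc t′ ]) (sym (begin
    sum (map (λ g → value (n ∸ g)) G)                  ≡⟨ sum-others (λ g → value (n ∸ g)) G uniqueG 0∈G ⟩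
    value n + S                                        ≡⟨ cong (_+ S) (trans (active W≤n) (cong (complement t′) (past W≤n))) ⟩
    complement t′ S + S                                ∎))
    (complement-spec t′ S)
    where
    open ≡-Reasoning
    S : ℕ
    S = sum (map (λ g → value (n ∸ g)) (others 0 G))

record LineWeights (t : ℕ) (G : List ℕ) : Set where
  field
    weight   : ℤ → ℕ
    weight<t : ∀ w → weight w < t
    window   : ∀ w → sum (map (λ g → weight (w -ℤ + g)) G) ≡ 1 [mod t ]

-- They exist when 0, W ∈ G ⊆ [0, W]: glue half-line weights for G on ℕ to
-- half-line weights for the mirror image W - G, read backwards, on the negatives.
lineWeights : ∀ t′ W (G : List ℕ) → Unique G → 0 ∈ G → W ∈ G → (∀ {g} → g ∈ G → g ≤ W) →
              LineWeights (suc t′) G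
lineWeights t′ W G uniqueG 0∈G W∈G G≤W = record
  { weight = weight ; weight<t = weight<t ; window = window }
  where
  G′ : List ℕ
  G′ = map (W ∸_) G

  G′≤W : ∀ {e} → e ∈ G′ → e ≤ W
  G′≤W e∈G′ with ∈-map⁻ (W ∸_) e∈G′
  ... | g , _ , refl = ℕP.m∸n≤m W g

  module R = HalfLineWeights (halfLineWeights t′ W G uniqueG 0∈G G≤W)
  module L = HalfLineWeights (halfLineWeights t′ W G′
    (map-unique (W ∸_) uniqueG (λ g∈ g′∈ → ℕP.∸-cancelˡ-≡ (G≤W g∈) (G≤W g′∈)))
    (subst (_∈ G′) (ℕP.n∸n≡0 W) (∈-map⁺ (W ∸_) W∈G))
    G′≤W)

  weight : ℤ → ℕ
  weight = glue R.weight (λ n → L.weight (W + n))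

  weight<t : ∀ w → weight w < suc t′
  weight<t (+ n)    = R.weight<t n
  weight<t -[1+ n ] = L.weight<t (W + n)

  reflect : ∀ {j} w → w +ℤ + suc j ≡ + W → weight w ≡ L.weight j
  reflect {j} (+ n) eq = trans (R.vanish (subst (n <_) e (ℕP.m<m+n n (s≤s z≤n))))
                               (sym (L.vanish (subst (j <_) e (ℕP.m≤n+m (suc j) n))))
    where
    e : n + suc j ≡ W
    e = ℤP.+-injective eq
  reflect {j} -[1+ n ] eq =
    cong L.weight (ℕP.suc-injective (sym (trans (ℤP.+-injective (solve-eq (+ suc j) (+ suc n) (+ W) eq)) (ℕP.+-suc W n))))
    where
    solve-eq : ∀ a b c → -ℤ b +ℤ a ≡ c → a ≡ c +ℤ b
    solve-eq a b c refl = lemma a b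
      where
      lemma : ∀ a b → a ≡ (-ℤ b +ℤ a) +ℤ b
      lemma = solve-∀

  position : ∀ w → (∃ λ n → w ≡ + n × W ≤ n) ⊎ (∃ λ k → w +ℤ + suc k ≡ + W)
  position (+ n) with W ≤? n
  ... | yes W≤n = inj₁ (n , refl , W≤n)
  ... | no  W≰n = inj₂ (W ∸ suc n , cong +_ (trans (ℕP.+-suc n _) (ℕP.m+[n∸m]≡n (ℕP.≰⇒> W≰n))))
  position -[1+ n ] = inj₂ (W + n , lemma (+ W) (+ n))
    where
    lemma : ∀ a b → -ℤ (+ 1 +ℤ b) +ℤ (+ 1 +ℤ (a +ℤ b)) ≡ a
    lemma = solve-∀

  window : ∀ w → sum (map (λ g → weight (w -ℤ + g)) G) ≡ 1 [mod suc t′ ]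
  window w with position w
  ... | inj₁ (n , refl , W≤n) = subst (_≡ 1 [mod suc t′ ]) (sym (sum-cong G λ g∈ →
          cong weight (minus-≥ (ℕP.≤-trans (G≤W g∈) W≤n))))
        (R.window W≤n)
  ... | inj₂ (k , w+k≡W) = subst (_≡ 1 [mod suc t′ ]) (sym (begin
          sum (map (λ g → weight (w -ℤ + g)) G)          ≡⟨ sum-cong G (λ {g} _ → reflect (w -ℤ + g) (shifted (+ g))) ⟩
          sum (map (λ g → L.weight (k + g)) G)           ≡⟨ sum-cong G (λ g∈ → cong L.weight (sym (unreflect g∈))) ⟩
          sum (map (λ g → L.weight ((k + W) ∸ (W ∸ g))) G) ≡⟨ cong sum (map-∘ G) ⟩
          sum (map (λ e → L.weight ((k + W) ∸ e)) G′)    ∎))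
        (L.window (ℕP.m≤n+m W k))
    where
    open ≡-Reasoning
    shifted : ∀ g → (w -ℤ g) +ℤ (+ suc k +ℤ g) ≡ + W
    shifted g = trans (lemma w g (+ suc k)) w+k≡W
      where
      lemma : ∀ w g s → (w -ℤ g) +ℤ (s +ℤ g) ≡ w +ℤ s
      lemma = solve-∀
    unreflect : ∀ {g} → g ∈ G → (k + W) ∸ (W ∸ g) ≡ k + g
    unreflect {g} g∈ = trans (ℕP.+-∸-assoc k (ℕP.m∸n≤m W g)) (cong (λ z → k + z) (ℕP.m∸[m∸n]≡n (G≤W g∈)))

glue-past : ∀ {A : Set} {f f′ g : ℕ → A} {n d} → 0 < d → (∀ {i} → i < n → f i ≡ f′ i) →
            glue f g (+ n -ℤ + d) ≡ glue f′ g (+ n -ℤ + d)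
glue-past {n = n} {d} 0<d agree with d ≤? n
... | yes d≤n rewrite minus-≥ d≤n = agree (ℕP.∸-monoʳ-< 0<d d≤n)
... | no  d≰n with minus-< (ℕP.≰⇒> d≰n)
...   | _ , eq rewrite eq = refl

fresh : ∀ {P} (L : List (Fin P)) → length L < P → ∃ λ c → c ∉ L
fresh {P} L |L|<P = FinP.¬∀⟶∃¬ P (_∈ L) (_∈? L) not-all
  where
  open DecMembership (FinP._≟_ {P}) using (_∈?_)
  not-all : ¬ (∀ c → c ∈ L)
  not-all all∈ with FinP.pigeonhole |L|<P (λ c → index (all∈ c))
  ... | i , j , i<j , same = FinP.<-irrefl (index-injective (setoid (Fin P)) (all∈ i) (all∈ j) same) i<j

-- Greedy colouring of ℕ with 1 + |D| colours, continuing a colouring `before` of the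
-- negative integers, such that n and n - d differ in colour for every gap d ∈ D.
module Greedy (D : List ℕ) (D⁺ : ∀ {d} → d ∈ D → 0 < d) (before : ℕ → Fin (suc (length D))) where

  back : (ℕ → Fin (suc (length D))) → ℕ → ℕ → Fin (suc (length D))
  back c n d = glue c before (+ n -ℤ + d)

  avoid : (h : ℕ → Fin (suc (length D))) (n : ℕ) → ∃ λ c → c ∉ map (back h n) D
  avoid h n = fresh (map (back h n) D) (s≤s (ℕP.≤-reflexive (length-map (back h n) D)))

  step : ℕ → (ℕ → Fin (suc (length D))) → Fin (suc (length D))
  step n h = proj₁ (avoid h n)

  open CourseOfValues Fin.zero step public using (value)
  open CourseOfValues Fin.zero step using (history; history-correct)

  proper : ∀ n {d} → d ∈ D → value n ≢ back value n d
  proper n {d} d∈D same = proj₂ (avoid (history n) n)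
    (subst (_∈ map (back (history n) n) D)
           (trans (glue-past (D⁺ d∈D) history-correct) (sym same))
           (∈-map⁺ (back (history n) n) d∈D))

colouring : (D : List ℕ) → (∀ {d} → d ∈ D → 0 < d) →
            Σ (ℤ → Fin (suc (length D))) λ colour → ∀ v {d} → d ∈ D → colour v ≢ colour (v -ℤ + d)
colouring D D⁺ = glue Right.value Left.value , proper
  where
  module Left  = Greedy D D⁺ (λ _ → Fin.zero)
  module Right = Greedy D D⁺ Left.value

  proper : ∀ v {d} → d ∈ D → glue Right.value Left.value v ≢ glue Right.value Left.value (v -ℤ + d)
  proper (+ n)    d∈D = Right.proper n d∈D
  proper -[1+ n ] {d} d∈D same = Left.proper (n + d) d∈D (begin
    Left.value (n + d)                              ≡⟨ cong (glue Right.value Left.value) (negative-minus n d) ⟨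
    glue Right.value Left.value (-[1+ n ] -ℤ + d)  ≡⟨ same ⟨
    Left.value n                                    ≡⟨ cong (glue Left.value (λ _ → Fin.zero)) (trans (minus-≥ (ℕP.m≤n+m d n)) (cong +_ (ℕP.m+n∸n≡m n d))) ⟨
    Left.back Left.value (n + d) d ∎)
    where open ≡-Reasoning

gaps : List ℕ → List ℕ
gaps G = filter (λ d → 0 <? d) (cartesianProductWith _∸_ G G)

-- A nonempty G has fewer than |G|² gaps, as the difference g - g = 0 is not one.
gaps-bound : ∀ {g₀ G} → g₀ ∈ G → length (gaps G) < length G * length G
gaps-bound {g₀} {G} g₀∈G = subst (length (gaps G) <_) (length-cartesianProductWith _∸_ G G)
  (filter-notAll (λ d → 0 <? d) _ (lose (subst (_∈ cartesianProductWith _∸_ G G) (ℕP.n∸n≡0 g₀)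
                                               (∈-cartesianProductWith⁺ _∸_ g₀∈G g₀∈G))
                                        (λ ())))

offsetColouring : ∀ {g₀} (G : List ℕ) → g₀ ∈ G →
                  Σ (ℤ → Fin (length G * length G)) λ colour →
                    ∀ w {g g′} → g ∈ G → g′ ∈ G → g ≢ g′ → colour (w -ℤ + g) ≢ colour (w -ℤ + g′)
offsetColouring G g₀∈G = (λ v → Fin.inject≤ (γ v) (gaps-bound g₀∈G)) , distinct
  where
  gapColouring : Σ (ℤ → Fin (suc (length (gaps G)))) λ colour →
                   ∀ v {d} → d ∈ gaps G → colour v ≢ colour (v -ℤ + d)
  gapColouring = colouring (gaps G) (λ d∈ → proj₂ (∈-filter⁻ (λ d → 0 <? d) {xs = cartesianProductWith _∸_ G G} d∈))
  γ : ℤ → Fin (suc (length (gaps G)))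
  γ = proj₁ gapColouring

  further : ∀ w {g g′} → g ≤ g′ → (w -ℤ + g) -ℤ + (g′ ∸ g) ≡ w -ℤ + g′
  further w {g} {g′} g≤g′ = trans (cong (λ z → (w -ℤ + g) -ℤ z) (sym (minus-≥ g≤g′))) (lemma w (+ g) (+ g′))
    where
    lemma : ∀ w a b → (w -ℤ a) -ℤ (b -ℤ a) ≡ w -ℤ b
    lemma = solve-∀

  apart : ∀ w {g g′} → g ∈ G → g′ ∈ G → g < g′ → γ (w -ℤ + g) ≢ γ (w -ℤ + g′)
  apart w {g} {g′} g∈G g′∈G g<g′ = subst (λ v → γ (w -ℤ + g) ≢ γ v) (further w (ℕP.<⇒≤ g<g′))
    (proj₂ gapColouring (w -ℤ + g)
      (∈-filter⁺ (λ d → 0 <? d) (∈-cartesianProductWith⁺ _∸_ g′∈G g∈G) (ℕP.m<n⇒0<n∸m g<g′)))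

  distinct : ∀ w {g g′} → g ∈ G → g′ ∈ G → g ≢ g′ →
             Fin.inject≤ (γ (w -ℤ + g)) (gaps-bound g₀∈G) ≢ Fin.inject≤ (γ (w -ℤ + g′)) (gaps-bound g₀∈G)
  distinct w {g} {g′} g∈G g′∈G g≢g′ same = order (ℕP.<-cmp g g′)
    where
    γ-same : γ (w -ℤ + g) ≡ γ (w -ℤ + g′)
    γ-same = FinP.inject≤-injective _ _ _ _ same
    order : Tri (g < g′) (g ≡ g′) (g′ < g) → ⊥
    order (tri< g<g′ _ _) = apart w g∈G g′∈G g<g′ γ-same
    order (tri≈ _ g≡g′ _) = g≢g′ g≡g′
    order (tri> _ _ g′<g) = apart w g′∈G g∈G g′<g (sym γ-same)

_⊖_ : ∀ {b} → ℤ^ b → ℤ^ b → ℤ^ b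
_⊖_ = zipWith _-ℤ_

⊕-⊖ : ∀ {b} (τ x : ℤ^ b) → τ ⊕ (x ⊖ τ) ≡ x
⊕-⊖ []      []      = refl
⊕-⊖ (a ∷ τ) (c ∷ x) = cong₂ _∷_ (lemma a c) (⊕-⊖ τ x)
  where
  lemma : ∀ a c → a +ℤ (c -ℤ a) ≡ c
  lemma = solve-∀

⊖-⊕ : ∀ {b} (τ y : ℤ^ b) → (τ ⊕ y) ⊖ τ ≡ y
⊖-⊕ []      []      = refl
⊖-⊕ (a ∷ τ) (c ∷ y) = cong₂ _∷_ (lemma a c) (⊖-⊕ τ y)
  where
  lemma : ∀ a c → (a +ℤ c) -ℤ a ≡ c
  lemma = solve-∀

horner : ℤ → ∀ {b} → ℤ^ b → ℤ
horner M []      = 0ℤ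
horner M (a ∷ v) = a +ℤ M *ℤ horner M v

horner-⊕ : ∀ M {b} (u v : ℤ^ b) → horner M (u ⊕ v) ≡ horner M u +ℤ horner M v
horner-⊕ M []      []      = refl
horner-⊕ M (a ∷ u) (c ∷ v) =
  trans (cong (λ h → (a +ℤ c) +ℤ M *ℤ h) (horner-⊕ M u v)) (lemma a c M (horner M u) (horner M v))
  where
  lemma : ∀ a c M p q → (a +ℤ c) +ℤ M *ℤ (p +ℤ q) ≡ (a +ℤ M *ℤ p) +ℤ (c +ℤ M *ℤ q)
  lemma = solve-∀

norm : ∀ {b} → ℤ^ b → ℕ
norm []      = 0
norm (a ∷ v) = ∣ a ∣ + norm v

digits-unique : ∀ M {a c p q} → ∣ a -ℤ c ∣ < M → a +ℤ + M *ℤ p ≡ c +ℤ + M *ℤ q → a ≡ c × p ≡ q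
digits-unique M {a} {c} {p} {q} small eq =
  ℤP.i-j≡0⇒i≡j a c (trans difference (trans (cong (+ M *ℤ_) q-p≡0) (ℤP.*-zeroʳ (+ M)))) ,
  sym (ℤP.i-j≡0⇒i≡j q p q-p≡0)
  where
  difference : a -ℤ c ≡ + M *ℤ (q -ℤ p)
  difference = trans (lemma a c (+ M) p) (trans (cong (_-ℤ (c +ℤ + M *ℤ p)) eq) (lemma′ c (+ M) p q))
    where
    lemma : ∀ a c M p → a -ℤ c ≡ (a +ℤ M *ℤ p) -ℤ (c +ℤ M *ℤ p)
    lemma = solve-∀
    lemma′ : ∀ c M p q → (c +ℤ M *ℤ q) -ℤ (c +ℤ M *ℤ p) ≡ M *ℤ (q -ℤ p)
    lemma′ = solve-∀

  below-base : ∀ k → M * k < M → k ≡ 0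
  below-base zero    _     = refl
  below-base (suc k) Mk<M = contradiction (ℕP.m≤m*n M (suc k)) (ℕP.<⇒≱ Mk<M)

  q-p≡0 : q -ℤ p ≡ 0ℤ
  q-p≡0 = ℤP.∣i∣≡0⇒i≡0 (below-base ∣ q -ℤ p ∣
    (subst (_< M) (trans (cong ∣_∣ difference) (ℤP.abs-* (+ M) (q -ℤ p))) small))

horner-injective : ∀ R {b} (u v : ℤ^ b) → norm u ≤ R → norm v ≤ R →
                   horner (+ suc (R + R)) u ≡ horner (+ suc (R + R)) v → u ≡ v
horner-injective R []      []      _  _  _  = refl
horner-injective R (a ∷ u) (c ∷ v) ‖u‖ ‖v‖ eq =
  cong₂ _∷_ (proj₁ digits) (horner-injective R u v (ℕP.m+n≤o⇒n≤o ∣ a ∣ ‖u‖) (ℕP.m+n≤o⇒n≤o ∣ c ∣ ‖v‖) (proj₂ digits))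
  where
  small : ∣ a -ℤ c ∣ < suc (R + R)
  small = s≤s (ℕP.≤-trans (ℤP.∣i-j∣≤∣i∣+∣j∣ a c) (ℕP.+-mono-≤ (ℕP.m+n≤o⇒m≤o ∣ a ∣ ‖u‖) (ℕP.m+n≤o⇒m≤o ∣ c ∣ ‖v‖)))
  digits : a ≡ c × horner (+ suc (R + R)) u ≡ horner (+ suc (R + R)) v
  digits = digits-unique (suc (R + R)) small eq

≤-sum : ∀ {x xs} → x ∈ xs → x ≤ sum xs
≤-sum {xs = x ∷ xs} (here refl) = ℕP.m≤m+n x (sum xs)
≤-sum {xs = y ∷ xs} (there x∈xs) = ℕP.≤-trans (≤-sum x∈xs) (ℕP.m≤n+m (sum xs) y)

record Projection {b} (T : List (ℤ^ b)) : Set where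
  field
    Φ           : ℤ^ b → ℤ
    Φ-⊕         : ∀ u v → Φ (u ⊕ v) ≡ Φ u +ℤ Φ v
    Φ-injective : ∀ {τ τ′} → τ ∈ T → τ′ ∈ T → Φ τ ≡ Φ τ′ → τ ≡ τ′

-- Such a map exists: base-M reading with M larger than twice every coordinate in T.
projection : ∀ {b} (T : List (ℤ^ b)) → Projection T
projection T = record
  { Φ = horner M ; Φ-⊕ = horner-⊕ M
  ; Φ-injective = λ τ∈T τ′∈T → horner-injective R _ _ (bounded τ∈T) (bounded τ′∈T) }
  where
  R : ℕ
  R = sum (map norm T)
  M : ℤ
  M = + suc (R + R)
  bounded : ∀ {τ} → τ ∈ T → norm τ ≤ R
  bounded τ∈T = ≤-sum (∈-map⁺ norm τ∈T)

module Offsets {b} (τ₀ : ℤ^ b) (Ts : List (ℤ^ b)) (projectionT : Projection (τ₀ ∷ Ts)) where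

  open Projection projectionT

  private
    T : List (ℤ^ b)
    T = τ₀ ∷ Ts
    module Lowest  = Extrema ℤP.≤-totalOrder
    module Highest = Extrema ℕP.≤-totalOrder

  lowest : ℤ^ b
  lowest = Lowest.argmin Φ τ₀ Ts

  base : ℤ
  base = Φ lowest

  offset : ℤ^ b → ℕ
  offset τ = ∣ Φ τ -ℤ base ∣

  base≤ : ∀ {τ} → τ ∈ T → base ≤ℤ Φ τ
  base≤ (here refl)  = Lowest.f[argmin]≤f[⊤] {f = Φ} τ₀ Ts
  base≤ (there τ∈Ts) = All.lookup (Lowest.f[argmin]≤f[xs] {f = Φ} τ₀ Ts) τ∈Ts

  height : ∀ {τ} → τ ∈ T → Φ τ ≡ base +ℤ + offset τ
  height {τ} τ∈T = trans (sym (lemma (Φ τ) base)) (cong (base +ℤ_) (sym (ℤP.0≤i⇒+∣i∣≡i (ℤP.i≤j⇒0≤j-i (base≤ τ∈T)))))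
    where
    lemma : ∀ a c → c +ℤ (a -ℤ c) ≡ a
    lemma = solve-∀

  offset-injective : ∀ {τ τ′} → τ ∈ T → τ′ ∈ T → offset τ ≡ offset τ′ → τ ≡ τ′
  offset-injective τ∈T τ′∈T same =
    Φ-injective τ∈T τ′∈T (trans (height τ∈T) (trans (cong (λ o → base +ℤ + o) same) (sym (height τ′∈T))))

  G : List ℕ
  G = map offset T

  G-unique : Unique T → Unique G
  G-unique uniqueT = map-unique offset uniqueT offset-injective

  0∈G : 0 ∈ G
  0∈G = subst (_∈ G) (cong ∣_∣ (ℤP.+-inverseʳ base))
          (∈-map⁺ offset (Lowest.argmin-all Φ {P = _∈ T} (here refl) (All.tabulate there)))

  highest : ℤ^ b
  highest = Highest.argmax offset τ₀ Ts

  W : ℕ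
  W = offset highest

  W∈G : W ∈ G
  W∈G = ∈-map⁺ offset (Highest.argmax-all offset {P = _∈ T} (here refl) (All.tabulate there))

  G≤W : ∀ {g} → g ∈ G → g ≤ W
  G≤W g∈G with ∈-map⁻ offset g∈G
  ... | τ , here refl  , refl = Highest.f[⊥]≤f[argmax] {f = offset} τ₀ Ts
  ... | τ , there τ∈Ts , refl = All.lookup (Highest.f[xs]≤f[argmax] {f = offset} τ₀ Ts) τ∈Ts

  -- G has |T| elements, so |G|² colours fit into the bound on the family.
  length-G : length G * length G ≡ length T ^ 2
  length-G = trans (cong (λ n → n * n) (length-map offset T)) (cong (length T *_) (sym (ℕP.*-identityʳ (length T))))

  level : ℤ^ b → ℤ
  level y = Φ y +ℤ base

  level-anchor : ∀ x {τ} → τ ∈ T → level (x ⊖ τ) ≡ Φ x -ℤ + offset τ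
  level-anchor x {τ} τ∈T = rearrange (Φ x) base (+ offset τ) (Φ (x ⊖ τ)) (begin
    Φ x                                 ≡⟨ cong Φ (⊕-⊖ τ x) ⟨
    Φ (τ ⊕ (x ⊖ τ))                     ≡⟨ Φ-⊕ τ (x ⊖ τ) ⟩
    Φ τ +ℤ Φ (x ⊖ τ)                    ≡⟨ cong (_+ℤ Φ (x ⊖ τ)) (height τ∈T) ⟩
    (base +ℤ + offset τ) +ℤ Φ (x ⊖ τ)   ∎)
    where
    open ≡-Reasoning
    rearrange : ∀ h c o p → h ≡ (c +ℤ o) +ℤ p → p +ℤ c ≡ h -ℤ o
    rearrange _ c o p refl = lemma c o p
      where
      lemma : ∀ c o p → p +ℤ c ≡ ((c +ℤ o) +ℤ p) -ℤ o
      lemma = solve-∀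

  anchored-window : ∀ {t} (weights : LineWeights t G) → let open LineWeights weights in
                    ∀ x → sum (map (λ τ → weight (level (x ⊖ τ))) T) ≡ 1 [mod t ]
  anchored-window {t} weights x = subst (_≡ 1 [mod t ])
    (sym (trans (sum-cong T (λ τ∈T → cong weight (level-anchor x τ∈T))) (cong sum (map-∘ {g = λ g → weight (Φ x -ℤ + g)} {f = offset} T))))
    (window (Φ x))
    where open LineWeights weights

  anchored-separation : ∀ {P} {colour : ℤ → Fin P} →
    (∀ w {g g′} → g ∈ G → g′ ∈ G → g ≢ g′ → colour (w -ℤ + g) ≢ colour (w -ℤ + g′)) →
    ∀ x {τ τ′} → τ ∈ T → τ′ ∈ T → τ ≢ τ′ → colour (level (x ⊖ τ)) ≢ colour (level (x ⊖ τ′))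
  anchored-separation {colour = colour} distinct x {τ} {τ′} τ∈T τ′∈T τ≢τ′ same =
    distinct (Φ x) (∈-map⁺ offset τ∈T) (∈-map⁺ offset τ′∈T) (τ≢τ′ ∘ offset-injective τ∈T τ′∈T)
      (trans (cong colour (sym (level-anchor x τ∈T))) (trans same (cong colour (level-anchor x τ′∈T))))

-- The tiling determined by anchor data: on each translate T + y place mult y sets, all of
-- hue y.
module Tiling {b} (T : List (ℤ^ b)) (uniqueT : Unique T)
  {S : Set} {N : ℕ} (A : Fin N → S → Set) (disjoint : ∀ i j → i ≢ j → ∀ s → A i s → A j s → ⊥)
  {t′ P : ℕ} (room : t′ * P ≤ N)
  (mult : ℤ^ b → ℕ) (mult≤ : ∀ y → mult y ≤ t′)
  (window : ∀ x → sum (map (λ τ → mult (x ⊖ τ)) T) ≡ 1 [mod suc t′ ])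
  (hue : ℤ^ b → Fin P)
  (separated : ∀ x {τ τ′} → τ ∈ T → τ′ ∈ T → τ ≢ τ′ → hue (x ⊖ τ) ≢ hue (x ⊖ τ′))
  where

  label : Fin t′ → Fin P → Fin N
  label k c = Fin.inject≤ (Fin.combine k c) room

  label-injective : ∀ {k c k′ c′} → label k c ≡ label k′ c′ → k ≡ k′ × c ≡ c′
  label-injective {k} {c} {k′} {c′} e = FinP.combine-injective k c k′ c′ (FinP.inject≤-injective room room _ _ e)

  labels : ℤ^ b → List (Fin N)
  labels y = tabulate (λ (k : Fin (mult y)) → label (Fin.inject≤ k (mult≤ y)) (hue y))

  labels-unique : ∀ y → Unique (labels y)
  labels-unique y = UniqueP.tabulate⁺ (λ e → FinP.inject≤-injective _ _ _ _ (proj₁ (label-injective e)))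

  same-hue : ∀ {i y y′} → i ∈ labels y → i ∈ labels y′ → hue y ≡ hue y′
  same-hue i∈y i∈y′ with ∈-tabulate⁻ i∈y | ∈-tabulate⁻ i∈y′
  ... | _ , refl | _ , e = proj₂ (label-injective e)

  Tile : ℤ^ b → Fin N → Set
  Tile y i = i ∈ labels y

  X : ℤ^ b → S → Set
  X z s = Σ (ℤ^ b) λ y → Σ (Fin N) λ i → Tile y i × (z ∈Translate T by y) × A i s

  anchor : ∀ {z τ y : ℤ^ b} → z ≡ τ ⊕ y → z ⊖ τ ≡ y
  anchor {τ = τ} {y} refl = ⊖-⊕ τ y

  cover : ℤ^ b → List (Fin N)
  cover x = concatMap (λ τ → labels (x ⊖ τ)) T

  cover-unique : ∀ x → Unique (cover x)
  cover-unique x = concatMap-unique (λ τ → labels (x ⊖ τ)) uniqueT (λ _ → labels-unique _)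
    (λ τ∈T τ′∈T τ≢τ′ (i∈ , i∈′) → separated x τ∈T τ′∈T τ≢τ′ (same-hue i∈ i∈′))

  length-cover : ∀ x → length (cover x) ≡ sum (map (λ τ → mult (x ⊖ τ)) T)
  length-cover x = trans (length-concatMap _ T) (cong sum (map-cong (λ τ → length-tabulate _) T))

  covered : ∀ {x s} → X x s → Any (λ i → A i s) (cover x)
  covered {x} (y , i , i∈y , (τ , τ∈T , x≡τ⊕y) , a) =
    lose (∈-concatMap⁺ (λ τ → labels (x ⊖ τ)) (lose τ∈T (subst (λ w → i ∈ labels w) (sym (anchor x≡τ⊕y)) i∈y))) a

  uncovered : ∀ {x s} → Any (λ i → A i s) (cover x) → X x s
  uncovered {x} p with find p
  ... | i , i∈cover , a with find (∈-concatMap⁻ (λ τ → labels (x ⊖ τ)) {xs = T} i∈cover)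
  ...   | τ , τ∈T , i∈labels = x ⊖ τ , i , i∈labels , (τ , τ∈T , sym (⊕-⊖ τ x)) , a

  -- Distinct tiles are disjoint: equal labels at two anchors of a point force equal anchors.
  tiles-disjoint : ∀ y i y′ j → Tile y i → Tile y′ j → ¬ ((y , i) ≡ (y′ , j)) →
                   ∀ z s → z ∈Translate T by y → A i s → z ∈Translate T by y′ → A j s → ⊥
  tiles-disjoint y i y′ j i∈y j∈y′ different z s (τ , τ∈T , z≡τ⊕y) a (τ′ , τ′∈T , z≡τ′⊕y′) a′ with i FinP.≟ j
  ... | no i≢j = disjoint i j i≢j s a a′
  ... | yes refl with ≡-dec ℤP._≟_ τ τ′
  ...   | yes refl = different (cong (_, i) (trans (sym (anchor z≡τ⊕y)) (anchor z≡τ′⊕y′)))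
  ...   | no τ≢τ′ = separated z τ∈T τ′∈T τ≢τ′
                      (same-hue (subst (λ w → i ∈ labels w) (sym (anchor z≡τ⊕y)) i∈y)
                                (subst (λ w → i ∈ labels w) (sym (anchor z≡τ′⊕y′)) j∈y′))

  fibre : ∀ x → Σ ℕ λ m → (m ≡ 1 [mod suc t′ ]) × (Σ (Fin m → Fin N) λ f → Injective _≡_ _≡_ f
            × (∀ s → (X x s → ∃ λ k → A (f k) s) × ((∃ λ k → A (f k) s) → X x s)))
  fibre x = length (cover x) , subst (_≡ 1 [mod suc t′ ]) (sym (length-cover x)) (window x)
          , lookup (cover x) , lookup-injective (cover-unique x)
          , λ s → (λ p → index (covered p) , lookup-index (covered p))
                , (λ (k , a) → uncovered (lose (∈-lookup k) a))

lemma13 : (t b : ℕ) → 1 ≤ t → 1 ≤ b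
    → (T : List (ℤ^ b)) → Unique T → T ≢ []
    → (S : Set) → (N : ℕ) → (A : Fin N → S → Set)
    → (∀ i j → i ≢ j → ∀ s → A i s → A j s → ⊥)
    → (t ∸ 1) * (length T ^ 2) ≤ N
    → Σ (ℤ^ b → S → Set) λ X →
        (Σ (ℤ^ b → Fin N → Set) λ Tile →
            (∀ z s → (X z s → Σ (ℤ^ b) λ x → Σ (Fin N) λ i → Tile x i × (z ∈Translate T by x) × A i s)
                   × ((Σ (ℤ^ b) λ x → Σ (Fin N) λ i → Tile x i × (z ∈Translate T by x) × A i s) → X z s))
          × (∀ x i x′ j → Tile x i → Tile x′ j → ¬ ((x , i) ≡ (x′ , j))
               → ∀ z s → z ∈Translate T by x → A i s → z ∈Translate T by x′ → A j s → ⊥))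
      × (∀ x → Σ ℕ λ m → (m ≡ 1 [mod t ]) × (Σ (Fin m → Fin N) λ f → Injective _≡_ _≡_ f
               × (∀ s → (X x s → ∃ λ k → A (f k) s) × ((∃ λ k → A (f k) s) → X x s))))
lemma13 zero      _ ()
lemma13 (suc t′) _ _ _ []        _       T≢[] _ _ _ _        _    = ⊥-elim (T≢[] refl)
lemma13 (suc t′) _ _ _ (τ₀ ∷ Ts) uniqueT _    S N A disjoint room =
  X , (Tile , (λ _ _ → id , id) , tiles-disjoint) , fibre
  where
  open Offsets τ₀ Ts (projection (τ₀ ∷ Ts))
  weights : LineWeights (suc t′) G
  weights = lineWeights t′ W G (G-unique uniqueT) 0∈G W∈G G≤W
  open LineWeights weights
  hues : Σ (ℤ → Fin (length G * length G)) λ colour →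
           ∀ w {g g′} → g ∈ G → g′ ∈ G → g ≢ g′ → colour (w -ℤ + g) ≢ colour (w -ℤ + g′)
  hues = offsetColouring G 0∈G
  open Tiling (τ₀ ∷ Ts) uniqueT A disjoint (subst (λ P → t′ * P ≤ N) (sym length-G) room)
              (weight ∘ level) (ℕP.≤-pred ∘ weight<t ∘ level) (anchored-window weights)
              (proj₁ hues ∘ level) (anchored-separation {colour = proj₁ hues} (proj₂ hues))
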